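{- For every $p_0\in\mathbb{N}\setminus P$ the series \[ s(p_0)=\sum_{i=1}^\infty \frac{1}{p_i(p_0)} \] converges, where $p_i(p_0)$ denotes the $i$-th element of the Eratosthenes ray of base $p_0$.
   Context: $P$ is the set of primes and $\pi^{ -1}(n)$ the $n$-th prime. For a natural number $p_0$, define $p_{k+1}(p_0)=\pi^{ -1}(p_k(p_0))$ for $k\ge0$ with $p_0(p_0)=p_0$; the Eratosthenes ray of base $p_0$ is $\{p_i(p_0): i\ge1\}$. -}

module Defs where

open import Data.Nat using (ℕ; zero; suc; _+_; _≤_; _!)

open import Data.Nat.Primality using (Prime; prime?)
open import Data.Integer using (+_)
open import Data.Rational using (ℚ; _/_; 0ℚ) renaming (_+_ to _+ℚ_)
open import Relation.Nullary using (yes; no)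

-- search for the least prime among m , m+1 , … , m+fuel-1 ; returns 0 if none
-- (never happens for the fuel used below, by Euclid's bound)
searchPrime : ℕ → ℕ → ℕ
searchPrime zero m = zero
searchPrime (suc fuel) m with prime? m
... | yes _ = m
... | no _ = searchPrime fuel (suc m)

-- least prime strictly greater than m (there is one ≤ m ! + 1)
nextPrime : ℕ → ℕ
nextPrime m = searchPrime (m !) (suc m)

-- π⁻¹ n : the n-th prime (1-indexed: π⁻¹ 1 = 2, π⁻¹ 2 = 3, …);
-- π⁻¹ 0 = 1 is a meaningless default value
π⁻¹ : ℕ → ℕ
π⁻¹ zero = 1
π⁻¹ (suc n) = nextPrime (π⁻¹ n)

ray : ℕ → ℕ → ℕ
ray zero p₀ = p₀
ray (suc k) p₀ = π⁻¹ (ray k p₀)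

-- 1/n as a rational (n ≥ 1); default 0 for n = 0
recip : ℕ → ℚ
recip zero = 0ℚ
recip (suc n) = (+ 1) / suc n

partialSum : ℕ → ℕ → ℚ
partialSum p₀ zero = 0ℚ
partialSum p₀ (suc n) = partialSum p₀ n +ℚ recip (ray (suc n) p₀)

-- Write bᵢ = pᵢ(p₀) − 1. Beyond 2 all primes are odd, so π⁻¹ k ≥ 2k − 1, and applying
-- this along the ray gives bᵢ₊₁ ≥ 2bᵢ. Then 1/(bᵢ + 1) + 2/bᵢ₊₁ ≤ 2/bᵢ, which telescopes
-- to bound the tail of the series after index i by 2/bᵢ ≤ 2/(i + 1).
module Submission where

open import Defs

module Primes where

  open import Data.Nat
  open import Data.Nat.Properties
  open import Data.Nat.Divisibility
  open import Data.Nat.Primality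
  open import Data.Nat.Primality.Factorisation using (factorise)
  open import Data.Nat.ListAction using (product)
  open import Data.List using ([]; _∷_)
  open import Data.List.Relation.Unary.All using (_∷_)
  open import Data.Product using (∃; _×_; _,_; proj₁; proj₂; map₂)
  open import Data.Sum using (_⊎_; inj₁; inj₂)
  open import Relation.Nullary using (yes; no; contradiction)
  open import Relation.Binary.PropositionalEquality

  prime>1 : ∀ {p} → Prime p → 1 < p
  prime>1 {p} pp = nonTrivial⇒n>1 p {{prime⇒nonTrivial pp}}

  ∃prime∣ : ∀ {n} → 1 < n → ∃ λ p → Prime p × p ∣ n
  ∃prime∣ {n@(suc _)} 1<n with factorise n
  ... | record { factors = [] ; isFactorisation = n≡1 } = contradiction n≡1 (>⇒≢ 1<n)
  ... | record { factors = p ∷ ps ; isFactorisation = n≡p*Πps ; factorsPrime = pp ∷ _ } =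
    p , pp , subst (p ∣_) (sym n≡p*Πps) (m∣m*n (product ps))

  n∣n! : ∀ n → .{{NonZero n}} → n ∣ n !
  n∣n! (suc n) = m∣m*n (n !)

  euclid : ∀ m → ∃ λ p → Prime p × m < p × p ≤ suc (m !)
  euclid m with ∃prime∣ (s≤s (1≤n! m))
  ... | p , pp , p∣1+m! = p , pp , m<p , ∣⇒≤ p∣1+m!
    where
    m<p : m < p
    m<p = ≰⇒> λ p≤m → ¬prime[1] (subst Prime (∣1⇒≡1 (p∣1 p≤m)) pp)
      where
      p∣1 : p ≤ m → p ∣ 1
      p∣1 p≤m = ∣m+n∣m⇒∣n (subst (p ∣_) (+-comm 1 (m !)) p∣1+m!)
                  (∣-trans (n∣n! p {{prime⇒nonZero pp}}) (m≤n⇒m!∣n! p≤m))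

  searchPrime-sound : ∀ fuel {m p} → Prime p → m ≤ p → p < m + fuel →
                      Prime (searchPrime fuel m) × m ≤ searchPrime fuel m
  searchPrime-sound zero {m} _ m≤p p<m+0 =
    contradiction (subst (_ <_) (+-identityʳ m) p<m+0) (≤⇒≯ m≤p)
  searchPrime-sound (suc fuel) {m} {p} pp m≤p p<m+1+fuel with prime? m
  ... | yes pm = pm , ≤-refl
  ... | no ¬pm = map₂ <⇒≤ (searchPrime-sound fuel pp
    (≤∧≢⇒< m≤p λ { refl → ¬pm pp }) (subst (p <_) (+-suc m fuel) p<m+1+fuel))

  -- For m = 0 the search fuel 0 ! = 1 is too small.
  nextPrime-sound : ∀ {m} → 1 ≤ m → Prime (nextPrime m) × m < nextPrime m
  nextPrime-sound {m} 1≤m =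
    let p , pp , m<p , p≤1+m! = euclid m
    in searchPrime-sound (m !) pp m<p (s≤s (≤-trans p≤1+m! (+-monoˡ-≤ (m !) 1≤m)))

  π⁻¹-prime : ∀ {n} → 1 ≤ n → Prime (π⁻¹ n)
  1≤π⁻¹ : ∀ n → 1 ≤ π⁻¹ n

  π⁻¹-prime {suc n} _ = proj₁ (nextPrime-sound (1≤π⁻¹ n))

  1≤π⁻¹ zero = ≤-refl
  1≤π⁻¹ (suc n) = <⇒≤ (prime>1 (π⁻¹-prime {suc n} z<s))

  π⁻¹-< : ∀ n → π⁻¹ n < π⁻¹ (suc n)
  π⁻¹-< n = proj₂ (nextPrime-sound (1≤π⁻¹ n))

  2∣n⊎2∣1+n : ∀ n → 2 ∣ n ⊎ 2 ∣ suc n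
  2∣n⊎2∣1+n zero = inj₁ (2 ∣0)
  2∣n⊎2∣1+n (suc n) with 2∣n⊎2∣1+n n
  ... | inj₁ (divides q n≡q*2) = inj₂ (divides (suc q) (cong (2 +_) n≡q*2))
  ... | inj₂ 2∣1+n = inj₁ 2∣1+n

  even-prime : ∀ {p} → Prime p → 2 ∣ p → p ≡ 2
  even-prime pp 2∣p with prime⇒irreducible pp 2∣p
  ... | inj₂ 2≡p = sym 2≡p

  consecutive-primes : ∀ {m} → Prime m → Prime (suc m) → m ≡ 2
  consecutive-primes pm p1+m with 2∣n⊎2∣1+n _
  ... | inj₁ 2∣m = even-prime pm 2∣m
  ... | inj₂ 2∣1+m = contradiction (subst Prime (suc-injective (even-prime p1+m 2∣1+m)) pm) ¬prime[1]

  nextPrime-gap : ∀ {m} → Prime m → 2 < m → 2 + m ≤ nextPrime m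
  nextPrime-gap {m} pm 2<m =
    let pn , m<n = nextPrime-sound (<⇒≤ (prime>1 pm))
    in ≤∧≢⇒< m<n λ 1+m≡n → >⇒≢ 2<m (consecutive-primes pm (subst Prime (sym 1+m≡n) pn))

  π⁻¹-lower : ∀ n → 2 * n ≤ suc (π⁻¹ n)
  π⁻¹-lower 0 = z≤n
  π⁻¹-lower 1 = s≤s (s≤s z≤n)
  π⁻¹-lower 2 = ≤-refl
  π⁻¹-lower (suc n@(suc (suc k))) = begin
    2 * suc n          ≡⟨ *-suc 2 n ⟩
    2 + 2 * n          ≤⟨ +-monoʳ-≤ 2 (π⁻¹-lower n) ⟩
    suc (2 + π⁻¹ n)    ≤⟨ s≤s (nextPrime-gap (π⁻¹-prime {n} z<s) 2<π⁻¹n) ⟩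
    suc (π⁻¹ (suc n))  ∎
    where
    open ≤-Reasoning
    2<π⁻¹n : 2 < π⁻¹ n
    2<π⁻¹n = ≤-<-trans (prime>1 (π⁻¹-prime {suc k} z<s)) (π⁻¹-< (suc k))

  π⁻¹-doubling : ∀ n → 2 * pred n ≤ pred (π⁻¹ n)
  π⁻¹-doubling zero = z≤n
  π⁻¹-doubling (suc n) =
    <⇒≤pred (≤-pred (subst (_≤ suc (π⁻¹ (suc n))) (*-suc 2 n) (π⁻¹-lower (suc n))))

  ray-prime : ∀ {p₀} → 1 ≤ p₀ → ∀ i → Prime (ray (suc i) p₀)
  ray-prime 1≤p₀ zero = π⁻¹-prime 1≤p₀
  ray-prime 1≤p₀ (suc i) = π⁻¹-prime (<⇒≤ (prime>1 (ray-prime 1≤p₀ i)))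

module Series where

  open import Data.Nat.Base as ℕ using (ℕ; zero; suc; z≤n; s≤s; _≤′_; ≤′-refl; ≤′-step)
  import Data.Nat.Properties as ℕ
  open import Data.Nat.Coprimality using (1-coprimeTo)
  open import Data.Integer using (+_; +0; +[1+_]; -[1+_]; +≤+; +<+)
  open import Data.Rational
  open import Data.Rational.Properties
  import Data.Rational.Unnormalised as ℚᵘ
  import Data.Rational.Unnormalised.Properties as ℚᵘ
  open import Algebra.Properties.AbelianGroup +-0-abelianGroup using (⁻¹-anti-homo‿-; xyx⁻¹≈y)
  open import Data.Product using (∃; _,_)
  open import Data.Sum using (inj₁; inj₂)
  open import Function using (_∘_)
  open import Relation.Binary.PropositionalEquality

  recip-suc : ∀ n → recip (suc n) ≡ mkℚ (+ 1) n (1-coprimeTo (suc n))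
  recip-suc n = normalize-coprime (1-coprimeTo (suc n))

  recip-nonNeg : ∀ n → 0ℚ ≤ recip n
  recip-nonNeg zero = ≤-refl
  recip-nonNeg (suc n) rewrite recip-suc n = nonNegative⁻¹ _

  recip-antimono : ∀ {m n} → 1 ℕ.≤ m → m ℕ.≤ n → recip n ≤ recip m
  recip-antimono {suc m} {suc n} _ m≤n rewrite recip-suc m | recip-suc n =
    *≤* (+≤+ (ℕ.*-monoʳ-≤ 1 m≤n))

  recip[2n]+recip[2n]≡recip[n] : ∀ {n} → 1 ℕ.≤ n → recip (2 ℕ.* n) + recip (2 ℕ.* n) ≡ recip n
  recip[2n]+recip[2n]≡recip[n] {suc n} _ = toℚᵘ-injective (begin
    toℚᵘ (r + r)                              ≈⟨ toℚᵘ-homo-+ r r ⟩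
    toℚᵘ r ℚᵘ.+ toℚᵘ r                         ≡⟨ cong (λ x → toℚᵘ x ℚᵘ.+ toℚᵘ x) (recip-suc _) ⟩
    ℚᵘ.mkℚᵘ (+ 1) d ℚᵘ.+ ℚᵘ.mkℚᵘ (+ 1) d       ≈⟨ ℚᵘ.*≡* (cong +_ cross-multiplied) ⟩
    ℚᵘ.mkℚᵘ (+ 1) n                           ≡⟨ cong toℚᵘ (recip-suc n) ⟨
    toℚᵘ (recip (suc n))                      ∎)
    where
    open ℚᵘ.≃-Reasoning
    m = 2 ℕ.* suc n
    r = recip m
    d = ℕ.pred m
    cross-multiplied : (1 ℕ.* m ℕ.+ 1 ℕ.* m) ℕ.* suc n ≡ 1 ℕ.* (m ℕ.* m)
    cross-multiplied = solve 1 (λ k → (con 1 :* (con 2 :* k) :+ con 1 :* (con 2 :* k)) :* k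
                                    := con 1 :* (con 2 :* k :* (con 2 :* k))) refl (suc n)
      where
      open import Data.Nat.Solver using (module +-*-Solver)
      open +-*-Solver

  2*n≤m⇒recip[m]+recip[m]≤recip[n] : ∀ {m n} → 1 ℕ.≤ n → 2 ℕ.* n ℕ.≤ m →
                                     recip m + recip m ≤ recip n
  2*n≤m⇒recip[m]+recip[m]≤recip[n] {m} {n} 1≤n 2n≤m = begin
    recip m + recip m                  ≤⟨ +-mono-≤ recip[m]≤recip[2n] recip[m]≤recip[2n] ⟩
    recip (2 ℕ.* n) + recip (2 ℕ.* n)  ≡⟨ recip[2n]+recip[2n]≡recip[n] 1≤n ⟩
    recip n                            ∎
    where
    open ≤-Reasoning
    recip[m]≤recip[2n] : recip m ≤ recip (2 ℕ.* n)
    recip[m]≤recip[2n] = recip-antimono (ℕ.≤-trans 1≤n (ℕ.m≤n*m n 2)) 2n≤m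

  ∃recip< : ∀ {ε} → 0ℚ < ε → ∃ λ c → recip (suc c) < ε
  ∃recip< {mkℚ +0 _ _} 0<ε with () ← positive 0<ε
  ∃recip< {mkℚ -[1+ _ ] _ _} 0<ε with () ← positive 0<ε
  ∃recip< {ε@(mkℚ +[1+ a ] d _)} _ = suc d , subst (_< ε) (sym (recip-suc (suc d)))
    (*<* (+<+ (ℕ.≤-trans (s≤s (ℕ.≤-reflexive (ℕ.*-identityˡ (suc d))))
                         (ℕ.m≤n*m (suc (suc d)) (suc a)))))

  p≤p+q : ∀ {p q} → 0ℚ ≤ q → p ≤ p + q
  p≤p+q {p} 0≤q = ≤-trans (≤-reflexive (sym (+-identityʳ p))) (+-monoʳ-≤ p 0≤q)

  ∣p-q∣≡∣q-p∣ : ∀ p q → ∣ p - q ∣ ≡ ∣ q - p ∣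
  ∣p-q∣≡∣q-p∣ p q = trans (sym (∣-p∣≡∣p∣ (p - q))) (cong ∣_∣ (⁻¹-anti-homo‿- p q))

  p≤q≤p+d⇒∣q-p∣≤d : ∀ {p q d} → p ≤ q → q ≤ p + d → ∣ q - p ∣ ≤ d
  p≤q≤p+d⇒∣q-p∣≤d {p} {q} {d} p≤q q≤p+d = begin
    ∣ q - p ∣  ≡⟨ 0≤p⇒∣p∣≡p (subst (_≤ q - p) (+-inverseʳ p) (+-monoˡ-≤ (- p) p≤q)) ⟩
    q - p      ≤⟨ +-monoˡ-≤ (- p) q≤p+d ⟩
    p + d - p  ≡⟨ xyx⁻¹≈y p d ⟩
    d          ∎
    where open ≤-Reasoning

  Cauchy : (ℕ → ℚ) → Set
  Cauchy s = (ε : ℚ) → 0ℚ < ε →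
    ∃ λ (N : ℕ) → (m n : ℕ) → N ℕ.≤ m → N ℕ.≤ n → ∣ s m - s n ∣ < ε

  Null : (ℕ → ℚ) → Set
  Null d = (ε : ℚ) → 0ℚ < ε → ∃ λ (N : ℕ) → (n : ℕ) → N ℕ.≤ n → d n < ε

  Cauchy-resp-≗ : ∀ {s t} → s ≗ t → Cauchy s → Cauchy t
  Cauchy-resp-≗ s≗t cauchy ε 0<ε with cauchy ε 0<ε
  ... | N , close = N , λ m n N≤m N≤n →
    subst₂ (λ x y → ∣ x - y ∣ < ε) (s≗t m) (s≗t n) (close m n N≤m N≤n)

  nondecreasing∧null-tail⇒Cauchy : ∀ {s d : ℕ → ℚ} →
    (∀ {m n} → m ℕ.≤ n → s m ≤ s n) →
    (∀ {m n} → m ℕ.≤ n → s n ≤ s m + d m) →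
    Null d → Cauchy s
  nondecreasing∧null-tail⇒Cauchy {s} {d} mono tail null ε 0<ε with null ε 0<ε
  ... | N , small = N , close
    where
    gap : ∀ {m n} → m ℕ.≤ n → ∣ s n - s m ∣ ≤ d m
    gap m≤n = p≤q≤p+d⇒∣q-p∣≤d (mono m≤n) (tail m≤n)
    close : ∀ m n → N ℕ.≤ m → N ℕ.≤ n → ∣ s m - s n ∣ < ε
    close m n N≤m N≤n with ℕ.≤-total n m
    ... | inj₁ n≤m = ≤-<-trans (gap n≤m) (small n N≤n)
    ... | inj₂ m≤n =
      subst (_< ε) (∣p-q∣≡∣q-p∣ (s n) (s m)) (≤-<-trans (gap m≤n) (small m N≤m))

  sumRecip : (ℕ → ℕ) → ℕ → ℚ
  sumRecip r zero = 0ℚ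
  sumRecip r (suc n) = sumRecip r n + recip (r n)

  partialSum≗sumRecip : ∀ {p₀ r} → (∀ i → ray (suc i) p₀ ≡ r i) → partialSum p₀ ≗ sumRecip r
  partialSum≗sumRecip r≡ zero = refl
  partialSum≗sumRecip r≡ (suc n) = cong₂ _+_ (partialSum≗sumRecip r≡ n) (cong recip (r≡ n))

  sumRecip-mono : ∀ r {m n} → m ℕ.≤ n → sumRecip r m ≤ sumRecip r n
  sumRecip-mono r m≤n = go (ℕ.≤⇒≤′ m≤n)
    where
    go : ∀ {m n} → m ≤′ n → sumRecip r m ≤ sumRecip r n
    go ≤′-refl = ≤-refl
    go (≤′-step {n} m≤′n) = ≤-trans (go m≤′n) (p≤p+q (recip-nonNeg (r n)))

  module Lacunary (b : ℕ → ℕ) (1≤b₀ : 1 ℕ.≤ b 0)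
                  (doubling : ∀ i → 2 ℕ.* b i ℕ.≤ b (suc i)) where

    <b : ∀ i → i ℕ.< b i
    <b zero = 1≤b₀
    <b (suc i) = begin-strict
      suc i          <⟨ s≤s (<b i) ⟩
      suc (b i)      ≤⟨ ℕ.+-monoˡ-≤ (b i) (ℕ.m<n⇒0<n (<b i)) ⟩
      b i ℕ.+ b i    ≡⟨ cong (b i ℕ.+_) (ℕ.+-identityʳ (b i)) ⟨
      2 ℕ.* b i      ≤⟨ doubling i ⟩
      b (suc i)      ∎
      where open ℕ.≤-Reasoning

    1≤b : ∀ i → 1 ℕ.≤ b i
    1≤b i = ℕ.m<n⇒0<n (<b i)

    tailBound : ℕ → ℚ
    tailBound i = recip (b i) + recip (b i)

    tailBound-nonNeg : ∀ i → 0ℚ ≤ tailBound i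
    tailBound-nonNeg i = ≤-trans (recip-nonNeg (b i)) (p≤p+q (recip-nonNeg (b i)))

    tailBound-step : ∀ i → recip (suc (b i)) + tailBound (suc i) ≤ tailBound i
    tailBound-step i = +-mono-≤ (recip-antimono (1≤b i) (ℕ.n≤1+n (b i)))
                                (2*n≤m⇒recip[m]+recip[m]≤recip[n] (1≤b i) (doubling i))

    s : ℕ → ℚ
    s = sumRecip (suc ∘ b)

    tail : ∀ {m n} → m ℕ.≤ n → s n ≤ s m + tailBound m
    tail {m} {n} m≤n = ≤-trans (p≤p+q (tailBound-nonNeg n)) (go (ℕ.≤⇒≤′ m≤n))
      where
      go : ∀ {n} → m ≤′ n → s n + tailBound n ≤ s m + tailBound m
      go ≤′-refl = ≤-refl
      go (≤′-step {n} m≤′n) = begin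
        s n + recip (suc (b n)) + tailBound (suc n)    ≡⟨ +-assoc (s n) _ _ ⟩
        s n + (recip (suc (b n)) + tailBound (suc n))  ≤⟨ +-monoʳ-≤ (s n) (tailBound-step n) ⟩
        s n + tailBound n                              ≤⟨ go m≤′n ⟩
        s m + tailBound m                              ∎
        where open ≤-Reasoning

    tailBound-null : Null tailBound
    tailBound-null ε 0<ε with ∃recip< 0<ε
    ... | c , recip[1+c]<ε = 2 ℕ.* suc c , λ n N≤n →
      ≤-<-trans (2*n≤m⇒recip[m]+recip[m]≤recip[n] (s≤s z≤n) (ℕ.≤-trans N≤n (ℕ.<⇒≤ (<b n))))
                recip[1+c]<ε

    sumRecip-Cauchy : Cauchy (sumRecip (suc ∘ b))
    sumRecip-Cauchy =
      nondecreasing∧null-tail⇒Cauchy (sumRecip-mono (suc ∘ b)) tail tailBound-null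

open Primes using (prime>1; π⁻¹-doubling; ray-prime)
open Series using (Cauchy-resp-≗; partialSum≗sumRecip; module Lacunary)
open import Data.Nat using (ℕ; _≤_; suc; pred)
open import Data.Nat.Properties using (suc-pred; <⇒≤pred)
open import Data.Nat.Primality using (Prime; prime⇒nonZero)
open import Data.Rational using (ℚ; 0ℚ; _<_; _-_; ∣_∣)
open import Data.Product using (∃)
open import Relation.Nullary using (¬_)
open import Relation.Binary.PropositionalEquality using (_≡_; sym)

theorem2 : (p₀ : ℕ) → 1 ≤ p₀ → ¬ Prime p₀ →
    (ε : ℚ) → 0ℚ < ε →
      ∃ λ (N : ℕ) → (m n : ℕ) → N ≤ m → N ≤ n →
        ∣ partialSum p₀ m - partialSum p₀ n ∣ < ε
theorem2 p₀ 1≤p₀ _ = Cauchy-resp-≗ (λ n → sym (partialSum≗sumRecip ray≡1+b n))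
  (Lacunary.sumRecip-Cauchy b 1≤b₀ (λ i → π⁻¹-doubling (ray (suc i) p₀)))
  where
  b : ℕ → ℕ
  b i = pred (ray (suc i) p₀)
  ray≡1+b : ∀ i → ray (suc i) p₀ ≡ suc (b i)
  ray≡1+b i = sym (suc-pred _ {{prime⇒nonZero (ray-prime 1≤p₀ i)}})
  1≤b₀ : 1 ≤ b 0
  1≤b₀ = <⇒≤pred (prime>1 (ray-prime 1≤p₀ 0))
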